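{- Let $i \geq 3$ be an integer and let $n = F_{i+1} + F_{i-2}$, where $(F_k)$ denotes the Fibonacci numbers indexed by $F_1 = 1$, $F_2 = 2$, $F_{k+1} = F_k + F_{k-1}$. Then Player 1 has a winning strategy for the reversed Zeckendorf game on $n$.
   Context: Fibonacci numbers are indexed $F_1=1$, $F_2=2$, $F_{k+1}=F_k+F_{k-1}$. A game state is a multiset of Fibonacci numbers ("chips") summing to $n$; the number of chips equal to $F_k$ is the height $h_k$ of bin $k$. The reversed Zeckendorf game on $n$ is a two-player game starting at the Zeckendorf decomposition of $n$ (the unique representation of $n$ as a sum of distinct, pairwise non-consecutive Fibonacci numbers $F_k$), one chip for each term. Players alternate moves; the legal moves are: (Split) for $k \geq 3$, if $h_k \geq 1$, replace one chip $F_k$ by one chip $F_{k-1}$ and one chip $F_{k-2}$; and if $h_2 \geq 1$, replace one chip $F_2$ by two chips $F_1$. (Combine) for $k > 2$, if $h_{k-2}\ge 1$ and $h_{k+1} \geq 1$, replace one chip $F_{k-2}$ and one chip $F_{k+1}$ by two chips $F_k$; and if $h_1 \geq 1$ and $h_3 \geq 1$, replace one chip $F_1$ and one chip $F_3$ by two chips $F_2$. A player who cannot move (which happens exactly when all chips equal $F_1$) loses. "Winning strategy" means a forced win regardless of the opponent's play. -}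

module Defs where

open import Data.Nat using (ℕ; zero; suc; _+_; _*_; _∸_; _≤_; _<_)
open import Data.Nat.Properties using (_≟_)
open import Data.Product using (Σ; _×_; ∃)
open import Relation.Nullary using (¬_; yes; no)
open import Relation.Binary.PropositionalEquality using (_≡_)

-- Fibonacci numbers with the paper's indexing F 1 = 1, F 2 = 2,
-- F (k+1) = F k + F (k-1).  (F 0 = 1 is forced by the recurrence and
-- is never used: bin 0 does not exist.)
F : ℕ → ℕ
F zero = 1
F (suc zero) = 1
F (suc (suc k)) = F (suc k) + F k

-- A game state is given by its heights: h k = number of chips equal to F k
-- (k ≥ 1; index 0 is unused and stays 0 in every state reachable from a
-- Zeckendorf decomposition).
State : Set
State = ℕ → ℕ

inc : ℕ → State → State
inc a h j with j ≟ a
... | yes _ = suc (h j)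
... | no  _ = h j

dec : ℕ → State → State
dec a h j with j ≟ a
... | yes _ = h j ∸ 1
... | no  _ = h j

data Mv : Set where
  split    : ℕ → Mv
  split2   : Mv
  combine  : ℕ → Mv
  combine2 : Mv

Legal : Mv → State → Set
Legal (split k)   h = 3 ≤ k × 1 ≤ h k
Legal split2      h = 1 ≤ h 2
Legal (combine k) h = 2 < k × 1 ≤ h (k ∸ 2) × 1 ≤ h (suc k)
Legal combine2    h = 1 ≤ h 1 × 1 ≤ h 3

apply : Mv → State → State
apply (split k)   h = inc (k ∸ 1) (inc (k ∸ 2) (dec k h))
apply split2      h = inc 1 (inc 1 (dec 2 h))
apply (combine k) h = inc k (inc k (dec (k ∸ 2) (dec (suc k) h)))
apply combine2    h = inc 2 (inc 2 (dec 1 (dec 3 h)))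

Move : State → State → Set
Move h h' = Σ Mv (λ m → Legal m h × (∀ j → h' j ≡ apply m h j))

-- Lose h : every move from h leads to a position won by the player to move
--          (in particular, a state with no legal move is Lose).
data Win : State → Set
data Lose : State → Set

data Win where
  win : ∀ {h} h' → Move h h' → Lose h' → Win h

data Lose where
  lose : ∀ {h} → (∀ h' → Move h h' → Win h') → Lose h

value : ℕ → State → ℕ
value zero h = 0
value (suc N) h = value N h + h (suc N) * F (suc N)

IsZeckendorf : ℕ → State → Set
IsZeckendorf n h =
  h 0 ≡ 0
  × (∀ k → h k ≤ 1)
  × (∀ k → ¬ (h k ≡ 1 × h (suc k) ≡ 1))
  × ∃ (λ N → (∀ k → N < k → h k ≡ 0) × value N h ≡ n)

-- The Zeckendorf state of F (i+1) + F (i-2) consists of exactly those two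
-- chips, so Player 1 may combine them into two chips F i.  In a state where
-- every bin has even height the player to move loses: whatever move the
-- opponent makes can be repeated (a move takes at most one chip from a bin,
-- never from a bin it adds to, and a nonempty even bin holds two chips), and
-- the repetition restores even heights.  The game ends because every move
-- strictly decreases Σ h j · 3 ^ j, taken over a bound on the occupied bins
-- that moves never exceed: 3 ^ k > 3 ^ (k-1) + 3 ^ (k-2) for splits and
-- 3 ^ (k+1) + 3 ^ (k-2) > 2 · 3 ^ k for combines.

{-# OPTIONS --safe #-}
module Submission where

open import Defs
open import Data.Nat using (ℕ; zero; suc; _+_; _*_; _∸_; _^_; _≤_; _<_; _⊔_; z≤n; s≤s; _≤?_; _<?_; z<s; NonZero; >-nonZero)
open import Data.Nat.Properties
open import Data.Nat.Divisibility using (_∣_; ∣⇒≤; ∣-refl; m∣m*n; ∣m∣n⇒∣m+n; ∣m+n∣m⇒∣n)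
open import Data.Nat.Induction using (<-wellFounded)
open import Data.Product using (_×_; _,_; proj₁; proj₂)
open import Data.List using (_∷_; [])
open import Data.Nat.Tactic.RingSolver using (solve)
open import Data.Sum using (_⊎_; inj₁; inj₂)
open import Function using (_∘_)
open import Induction.WellFounded using (Acc; acc)
open import Relation.Nullary using (Dec; yes; no; ¬_; contradiction)
open import Relation.Nullary.Decidable using (from-yes)
open import Relation.Binary.PropositionalEquality
open import Algebra.Properties.CommutativeSemigroup +-commutativeSemigroup using (interchange)

δ : ℕ → ℕ → ℕ
δ a j with j ≟ a
... | yes _ = 1
... | no  _ = 0

δ-self : ∀ a → δ a a ≡ 1
δ-self a with a ≟ a
... | yes _ = refl
... | no a≢a = contradiction refl a≢a

1≤δ-self : ∀ a → 1 ≤ δ a a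
1≤δ-self a = ≤-reflexive (sym (δ-self a))

δ-ne : ∀ {a j} → j ≢ a → δ a j ≡ 0
δ-ne {a} {j} j≢a with j ≟ a
... | yes j≡a = contradiction j≡a j≢a
... | no _ = refl

δ-zero-or-at : ∀ a j → δ a j ≡ 0 ⊎ j ≡ a
δ-zero-or-at a j with j ≟ a
... | yes j≡a = inj₂ j≡a
... | no _    = inj₁ refl

δ-lt : ∀ {a j} → a < j → δ a j ≡ 0
δ-lt = δ-ne ∘ ≢-sym ∘ <⇒≢

δ-gt : ∀ {a j} → j < a → δ a j ≡ 0
δ-gt = δ-ne ∘ <⇒≢

δ≤ : ∀ (h : State) {a} → 1 ≤ h a → ∀ j → δ a j ≤ h j
δ≤ h {a} p j with j ≟ a
... | yes refl = p
... | no _ = z≤n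

δ+δ≤ : ∀ (h : State) {a b} → a ≢ b → 1 ≤ h a → 1 ≤ h b → ∀ j → δ a j + δ b j ≤ h j
δ+δ≤ h {a} {b} a≢b p q j with j ≟ a
... | yes refl rewrite δ-ne {b} {j} a≢b = p
... | no _ = δ≤ h q j

δ+δ≤1 : ∀ {a b} → a ≢ b → ∀ j → δ a j + δ b j ≤ 1
δ+δ≤1 a≢b = δ+δ≤ (λ _ → 1) a≢b ≤-refl ≤-refl

inc-δ : ∀ a h j → inc a h j ≡ h j + δ a j
inc-δ a h j with j ≟ a
... | yes _ = +-comm 1 (h j)
... | no  _ = sym (+-identityʳ (h j))

dec-δ : ∀ a h j → dec a h j ≡ h j ∸ δ a j
dec-δ a h j with j ≟ a
... | yes _ = refl
... | no  _ = refl

inc-inc : ∀ a b h j → inc b (inc a h) j ≡ h j + (δ a j + δ b j)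
inc-inc a b h j = begin
  inc b (inc a h) j        ≡⟨ inc-δ b (inc a h) j ⟩
  inc a h j + δ b j        ≡⟨ cong (_+ δ b j) (inc-δ a h j) ⟩
  h j + δ a j + δ b j      ≡⟨ +-assoc (h j) (δ a j) (δ b j) ⟩
  h j + (δ a j + δ b j)    ∎
  where open ≡-Reasoning

dec-dec : ∀ a b h j → dec b (dec a h) j ≡ h j ∸ (δ a j + δ b j)
dec-dec a b h j = begin
  dec b (dec a h) j        ≡⟨ dec-δ b (dec a h) j ⟩
  dec a h j ∸ δ b j        ≡⟨ cong (_∸ δ b j) (dec-δ a h j) ⟩
  h j ∸ δ a j ∸ δ b j      ≡⟨ ∸-+-assoc (h j) (δ a j) (δ b j) ⟩
  h j ∸ (δ a j + δ b j)    ∎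
  where open ≡-Reasoning

removed : Mv → ℕ → ℕ
removed (split k)   j = δ k j
removed split2      j = δ 2 j
removed (combine k) j = δ (suc k) j + δ (k ∸ 2) j
removed combine2    j = δ 3 j + δ 1 j

added : Mv → ℕ → ℕ
added (split k)   j = δ (k ∸ 2) j + δ (k ∸ 1) j
added split2      j = δ 1 j + δ 1 j
added (combine k) j = δ k j + δ k j
added combine2    j = δ 2 j + δ 2 j

highestBin : Mv → ℕ
highestBin (split k)   = k
highestBin split2      = 2
highestBin (combine k) = suc k
highestBin combine2    = 3

apply-pointwise : ∀ m h j → apply m h j ≡ h j ∸ removed m j + added m j
apply-pointwise (split k)   h j = trans (inc-inc (k ∸ 2) (k ∸ 1) (dec k h) j) (cong (_+ _) (dec-δ k h j))
apply-pointwise split2      h j = trans (inc-inc 1 1 (dec 2 h) j) (cong (_+ _) (dec-δ 2 h j))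
apply-pointwise (combine k) h j = trans (inc-inc k k (dec (k ∸ 2) (dec (suc k) h)) j) (cong (_+ _) (dec-dec (suc k) (k ∸ 2) h j))
apply-pointwise combine2    h j = trans (inc-inc 2 2 (dec 1 (dec 3 h)) j) (cong (_+ _) (dec-dec 3 1 h j))

suc≢∸2 : ∀ k → suc k ≢ k ∸ 2
suc≢∸2 k = ≢-sym (<⇒≢ (s≤s (m∸n≤m k 2)))

removed≤1 : ∀ m j → removed m j ≤ 1
removed≤1 (split k)   j = δ≤ (λ _ → 1) ≤-refl j
removed≤1 split2      j = δ≤ (λ _ → 1) ≤-refl j
removed≤1 (combine k) j = δ+δ≤1 (suc≢∸2 k) j
removed≤1 combine2    j = δ+δ≤1 (λ ()) j

legal⇒removed≤ : ∀ {m h} → Legal m h → ∀ j → removed m j ≤ h j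
legal⇒removed≤ {split k}   {h} (_ , p)     = δ≤ h p
legal⇒removed≤ {split2}    {h} p           = δ≤ h p
legal⇒removed≤ {combine k} {h} (_ , p , q) = δ+δ≤ h (suc≢∸2 k) q p
legal⇒removed≤ {combine2}  {h} (p , q)     = δ+δ≤ h (λ ()) q p

legal⇒highestBin : ∀ {m h} → Legal m h → 1 ≤ h (highestBin m)
legal⇒highestBin {split k}   (_ , p)     = p
legal⇒highestBin {split2}    p           = p
legal⇒highestBin {combine k} (_ , _ , q) = q
legal⇒highestBin {combine2}  (_ , q)     = q

legal-transfer : ∀ {m h h'} → Legal m h → (∀ j → removed m j ≤ h' j) → Legal m h'
legal-transfer {split k}   (3≤k , _)     r≤ = 3≤k , ≤-trans (1≤δ-self k) (r≤ k)
legal-transfer {split2}    _             r≤ = ≤-trans (1≤δ-self 2) (r≤ 2)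
legal-transfer {combine k} (2<k , _ , _) r≤ =
  2<k , ≤-trans (≤-trans (1≤δ-self (k ∸ 2)) (m≤n+m _ _)) (r≤ (k ∸ 2))
      , ≤-trans (≤-trans (1≤δ-self (suc k)) (m≤m+n _ _)) (r≤ (suc k))
legal-transfer {combine2}  _             r≤ =
  ≤-trans (m≤n+m 1 (δ 3 1)) (r≤ 1) , ≤-trans (m≤m+n 1 (δ 1 3)) (r≤ 3)

removed-added-disjoint : ∀ {m h} → Legal m h → ∀ j → removed m j ≡ 0 ⊎ added m j ≡ 0
removed-added-disjoint {split .(3 + r)} (s≤s (s≤s (s≤s {n = r} z≤n)) , _) j with δ-zero-or-at (3 + r) j
... | inj₁ δ≡0 = inj₁ δ≡0
... | inj₂ refl = inj₂ (cong₂ _+_ (δ-lt (m<n+m (suc r) {2} z<s)) (δ-lt (n<1+n (2 + r))))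
removed-added-disjoint {split2} _ j with δ-zero-or-at 2 j
... | inj₁ δ≡0 = inj₁ δ≡0
... | inj₂ refl = inj₂ refl
removed-added-disjoint {combine .(3 + r)} (s≤s (s≤s (s≤s {n = r} z≤n)) , _) j with δ-zero-or-at (3 + r) j
... | inj₁ δ≡0 = inj₂ (cong₂ _+_ δ≡0 δ≡0)
... | inj₂ refl = inj₁ (cong₂ _+_ (δ-gt (n<1+n (3 + r))) (δ-lt (m<n+m (suc r) {2} z<s)))
removed-added-disjoint {combine2} _ j with δ-zero-or-at 2 j
... | inj₁ δ≡0 = inj₂ (cong₂ _+_ δ≡0 δ≡0)
... | inj₂ refl = inj₁ refl

added-vanishes-above : ∀ m {j} → highestBin m < j → added m j ≡ 0
added-vanishes-above (split k)   k<j = cong₂ _+_ (δ-lt (≤-<-trans (m∸n≤m k 2) k<j)) (δ-lt (≤-<-trans (m∸n≤m k 1) k<j))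
added-vanishes-above split2      2<j = cong₂ _+_ (δ-lt (<-trans (n<1+n 1) 2<j)) (δ-lt (<-trans (n<1+n 1) 2<j))
added-vanishes-above (combine k) k<j = cong₂ _+_ (δ-lt (<-trans (n<1+n k) k<j)) (δ-lt (<-trans (n<1+n k) k<j))
added-vanishes-above combine2    3<j = cong₂ _+_ (δ-lt (<-trans (n<1+n 2) 3<j)) (δ-lt (<-trans (n<1+n 2) 3<j))

Supported : ℕ → State → Set
Supported N h = ∀ j → N < j → h j ≡ 0

supported⇒≤ : ∀ {N h k} → Supported N h → 1 ≤ h k → k ≤ N
supported⇒≤ {N} {h} {k} supp p with k ≤? N
... | yes k≤N = k≤N
... | no  k≰N = contradiction (supp k (≰⇒> k≰N)) (m<n⇒n≢0 p)

potential : ℕ → (ℕ → ℕ) → ℕ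
potential zero    f = f 0 * 3 ^ 0
potential (suc N) f = potential N f + f (suc N) * 3 ^ suc N

potential-cong : ∀ N {f g} → f ≗ g → potential N f ≡ potential N g
potential-cong zero    f≗g = cong (_* 1) (f≗g 0)
potential-cong (suc N) f≗g = cong₂ _+_ (potential-cong N f≗g) (cong (_* 3 ^ suc N) (f≗g (suc N)))

potential-+ : ∀ N f g → potential N (λ j → f j + g j) ≡ potential N f + potential N g
potential-+ zero    f g = *-distribʳ-+ 1 (f 0) (g 0)
potential-+ (suc N) f g = begin
  potential N (λ j → f j + g j) + (f (suc N) + g (suc N)) * w
    ≡⟨ cong₂ _+_ (potential-+ N f g) (*-distribʳ-+ w (f (suc N)) (g (suc N))) ⟩
  potential N f + potential N g + (f (suc N) * w + g (suc N) * w)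
    ≡⟨ interchange (potential N f) (potential N g) (f (suc N) * w) (g (suc N) * w) ⟩
  potential N f + f (suc N) * w + (potential N g + g (suc N) * w) ∎
  where
  w : ℕ
  w = 3 ^ suc N
  open ≡-Reasoning

potential-δ-above : ∀ N {a} → N < a → potential N (δ a) ≡ 0
potential-δ-above zero    0<a = cong (_* 1) (δ-gt 0<a)
potential-δ-above (suc N) N<a
  rewrite potential-δ-above N (<-trans (n<1+n N) N<a) | δ-gt N<a = refl

potential-δ : ∀ N {a} → a ≤ N → potential N (δ a) ≡ 3 ^ a
potential-δ zero    z≤n = cong (_* 1) (δ-self 0)
potential-δ (suc N) {a} a≤N with m≤n⇒m<n∨m≡n a≤N
... | inj₁ a<1+N rewrite potential-δ N (<⇒≤pred a<1+N) | δ-lt {a} a<1+N = +-identityʳ (3 ^ a)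
... | inj₂ refl  rewrite potential-δ-above N (n<1+n N) | δ-self (suc N) = +-identityʳ (3 ^ suc N)

potential-δ+δ : ∀ N {a b} → a ≤ N → b ≤ N → potential N (λ j → δ a j + δ b j) ≡ 3 ^ a + 3 ^ b
potential-δ+δ N {a} {b} a≤N b≤N =
  trans (potential-+ N (δ a) (δ b)) (cong₂ _+_ (potential-δ N a≤N) (potential-δ N b≤N))

split-weights : ∀ x .{{_ : NonZero x}} → x + 3 * x < 3 * (3 * x)
split-weights x = subst (x + 3 * x <_) (*-assoc 3 3 x) (*-monoˡ-< x (from-yes (4 <? 9)))

combine-weights : ∀ x .{{_ : NonZero x}} → 3 * (3 * x) + 3 * (3 * x) < 3 * (3 * (3 * x)) + x
combine-weights x = begin-strict
  3 * (3 * x) + 3 * (3 * x) ≡⟨ solve (x ∷ []) ⟩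
  18 * x                    <⟨ *-monoˡ-< x (from-yes (18 <? 28)) ⟩
  28 * x                    ≡⟨ solve (x ∷ []) ⟩
  3 * (3 * (3 * x)) + x     ∎
  where open ≤-Reasoning

added<removed : ∀ {m h N} → Legal m h → highestBin m ≤ N → potential N (added m) < potential N (removed m)
added<removed {split .(3 + r)} {N = N} (s≤s (s≤s (s≤s {n = r} z≤n)) , _) k≤N =
  subst₂ _<_ (sym (potential-δ+δ N (≤-trans (m≤n+m (suc r) 2) k≤N) (≤-trans (n≤1+n _) k≤N)))
             (sym (potential-δ N k≤N))
             (split-weights (3 ^ suc r) {{m^n≢0 3 (suc r)}})
added<removed {split2} {N = N} _ 2≤N =
  subst₂ _<_ (sym (potential-δ+δ N 1≤N 1≤N)) (sym (potential-δ N 2≤N)) (from-yes (6 <? 9))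
  where
  1≤N : 1 ≤ N
  1≤N = ≤-trans (n≤1+n 1) 2≤N
added<removed {combine .(3 + r)} {N = N} (s≤s (s≤s (s≤s {n = r} z≤n)) , _) k+1≤N =
  subst₂ _<_ (sym (potential-δ+δ N k≤N k≤N))
             (sym (potential-δ+δ N k+1≤N (≤-trans (m≤n+m (suc r) 3) k+1≤N)))
             (combine-weights (3 ^ suc r) {{m^n≢0 3 (suc r)}})
  where
  k≤N : 3 + r ≤ N
  k≤N = ≤-trans (n≤1+n _) k+1≤N
added<removed {combine2} {N = N} _ 3≤N =
  subst₂ _<_ (sym (potential-δ+δ N 2≤N 2≤N)) (sym (potential-δ+δ N 3≤N 1≤N)) (from-yes (18 <? 30))
  where
  2≤N : 2 ≤ N
  2≤N = ≤-trans (n≤1+n 2) 3≤N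
  1≤N : 1 ≤ N
  1≤N = ≤-trans (n≤1+n 1) 2≤N

∸-+-cancel : ∀ {x r} a → r ≤ x → x ∸ r + a + r ≡ x + a
∸-+-cancel {x} {r} a r≤x = begin
  x ∸ r + a + r  ≡⟨ cong (_+ r) (+-∸-comm a r≤x) ⟨
  x + a ∸ r + r  ≡⟨ m∸n+n≡m (≤-trans r≤x (m≤m+n x a)) ⟩
  x + a          ∎
  where open ≡-Reasoning

move-decreases : ∀ {N m h h'} → Supported N h → Legal m h → h' ≗ apply m h →
                 potential N h' < potential N h × Supported N h'
move-decreases {N} {m} {h} {h'} supp legal h'≗ = decrease , supp'
  where
  top≤N : highestBin m ≤ N
  top≤N = supported⇒≤ supp (legal⇒highestBin legal)
  pointwise : ∀ j → h' j ≡ h j ∸ removed m j + added m j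
  pointwise j = trans (h'≗ j) (apply-pointwise m h j)
  conserved : ∀ j → h' j + removed m j ≡ h j + added m j
  conserved j = trans (cong (_+ removed m j) (pointwise j)) (∸-+-cancel (added m j) (legal⇒removed≤ legal j))
  decrease : potential N h' < potential N h
  decrease = +-cancelʳ-< (potential N (removed m)) (potential N h') (potential N h) (begin-strict
    potential N h' + potential N (removed m)  ≡⟨ potential-+ N h' (removed m) ⟨
    potential N (λ j → h' j + removed m j)     ≡⟨ potential-cong N conserved ⟩
    potential N (λ j → h j + added m j)       ≡⟨ potential-+ N h (added m) ⟩
    potential N h + potential N (added m)     <⟨ +-monoʳ-< (potential N h) (added<removed legal top≤N) ⟩
    potential N h + potential N (removed m)   ∎)
    where open ≤-Reasoning
  supp' : Supported N h'
  supp' j N<j rewrite pointwise j | supp j N<j | 0∸n≡0 (removed m j) =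
    added-vanishes-above m (≤-<-trans top≤N N<j)

2∣n+n : ∀ n → 2 ∣ n + n
2∣n+n n = subst (2 ∣_) (cong (n +_) (+-identityʳ n)) (m∣m*n {2} n)

repeatable : ∀ {x r} a → 2 ∣ x → r ≤ 1 → r ≤ x → r ≡ 0 ⊎ a ≡ 0 →
             r ≤ x ∸ r + a × 2 ∣ x ∸ r + a ∸ r + a
repeatable {x} a 2∣x z≤n _ _ = z≤n , subst (2 ∣_) (sym (+-assoc x a a)) (∣m∣n⇒∣m+n 2∣x (2∣n+n a))
repeatable _ _ (s≤s z≤n) _ (inj₁ ())
repeatable {suc zero} _ 2∣1 (s≤s z≤n) _ (inj₂ refl) = contradiction (∣⇒≤ 2∣1) (λ { (s≤s ()) })
repeatable {suc (suc y)} _ 2∣x (s≤s z≤n) _ (inj₂ refl) =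
  s≤s z≤n , subst (2 ∣_) (sym (trans (+-identityʳ (y + 0)) (+-identityʳ y))) (∣m+n∣m⇒∣n 2∣x ∣-refl)

mirror-loses : ∀ {N h} → Acc _<_ (potential N h) → Supported N h → (∀ j → 2 ∣ h j) → Lose h
mirror-loses {N} {h} (acc smaller) supp even = lose reply
  where
  reply : ∀ h' → Move h h' → Win h'
  reply h' (m , legal , h'≗) =
    win (apply m h') (m , legal' , λ _ → refl) (mirror-loses (smaller (<-trans (proj₁ second) (proj₁ first))) (proj₂ second) even₂)
    where
    pointwise : ∀ j → h' j ≡ h j ∸ removed m j + added m j
    pointwise j = trans (h'≗ j) (apply-pointwise m h j)
    repeat : ∀ j → removed m j ≤ h j ∸ removed m j + added m j
                 × 2 ∣ h j ∸ removed m j + added m j ∸ removed m j + added m j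
    repeat j = repeatable (added m j) (even j) (removed≤1 m j) (legal⇒removed≤ legal j)
                 (removed-added-disjoint legal j)
    legal' : Legal m h'
    legal' = legal-transfer legal (λ j → subst (removed m j ≤_) (sym (pointwise j)) (proj₁ (repeat j)))
    even₂ : ∀ j → 2 ∣ apply m h' j
    even₂ j = subst (2 ∣_)
      (sym (trans (apply-pointwise m h' j) (cong (λ y → y ∸ removed m j + added m j) (pointwise j))))
      (proj₂ (repeat j))
    first : potential N h' < potential N h × Supported N h'
    first = move-decreases supp legal h'≗
    second : potential N (apply m h') < potential N h' × Supported N (apply m h')
    second = move-decreases (proj₂ first) legal' (λ _ → refl)

even-state-loses : ∀ N {h} → Supported N h → (∀ j → 2 ∣ h j) → Lose h
even-state-loses N {h} = mirror-loses (<-wellFounded (potential N h))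

F-pos : ∀ k → 1 ≤ F k
F-pos zero          = ≤-refl
F-pos (suc zero)    = ≤-refl
F-pos (suc (suc k)) = ≤-trans (F-pos (suc k)) (m≤m+n _ _)

F-≤-suc : ∀ k → F k ≤ F (suc k)
F-≤-suc zero    = ≤-refl
F-≤-suc (suc k) = m≤m+n _ _

F-mono : ∀ {a b} → a ≤ b → F a ≤ F b
F-mono {b = zero}  z≤n = ≤-refl
F-mono {b = suc b} a≤1+b with m≤n⇒m<n∨m≡n a≤1+b
... | inj₁ (s≤s a≤b) = ≤-trans (F-mono a≤b) (F-≤-suc b)
... | inj₂ refl      = ≤-refl

F-≤-value : ∀ h {k M} → 1 ≤ h (suc k) → suc k ≤ M → F (suc k) ≤ value M h
F-≤-value h {k} {suc M} 1≤h k<M with m≤n⇒m<n∨m≡n k<M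
... | inj₁ (s≤s k<M') = ≤-trans (F-≤-value h 1≤h k<M') (m≤m+n _ _)
... | inj₂ refl       = ≤-trans (m≤n*m (F (suc k)) (h (suc k)) {{>-nonZero 1≤h}}) (m≤n+m _ _)

VanishesOn : ℕ → ℕ → State → Set
VanishesOn a b h = ∀ j → a < j → j ≤ b → h j ≡ 0

value-extend : ∀ h {k M} → k ≤ M → VanishesOn k M h → value M h ≡ value k h
value-extend h {k} {zero}  z≤n  _     = refl
value-extend h {k} {suc M} k≤1+M zeros with m≤n⇒m<n∨m≡n k≤1+M
... | inj₂ refl = refl
... | inj₁ (s≤s k≤M) rewrite zeros (suc M) (s≤s k≤M) ≤-refl | +-identityʳ (value M h) =
  value-extend h k≤M (λ j k<j j≤M → zeros j k<j (m≤n⇒m≤1+n j≤M))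

value≡0⇒vanishes : ∀ h {M} → value M h ≡ 0 → VanishesOn 0 M h
value≡0⇒vanishes h value≡0 (suc j) _ j≤M =
  n<1⇒n≡0 (≰⇒> (λ 1≤h → <⇒≱ (subst (_< F (suc j)) (sym value≡0) (F-pos (suc j))) (F-≤-value h 1≤h j≤M)))

module _ {h : State} (h≤1 : ∀ k → h k ≤ 1) (no-consecutive : ∀ k → ¬ (h k ≡ 1 × h (suc k) ≡ 1)) where

  empty-before-chip : ∀ k → h (suc k) ≡ 1 → h k ≡ 0
  empty-before-chip k chip with n≤1⇒n≡0∨n≡1 (h≤1 k)
  ... | inj₁ empty = empty
  ... | inj₂ full  = contradiction (full , chip) (no-consecutive k)

  value<F-step : ∀ M → value M h < F (suc M) → value (suc M) h < F (suc (suc M)) →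
                 value (suc (suc M)) h < F (suc (suc (suc M)))
  value<F-step M bound bound₁ with n≤1⇒n≡0∨n≡1 (h≤1 (suc (suc M)))
  ... | inj₁ empty rewrite empty | +-identityʳ (value (suc M) h) =
    <-≤-trans bound₁ (F-≤-suc (suc (suc M)))
  ... | inj₂ chip rewrite chip | empty-before-chip (suc M) chip
                        | +-identityʳ (value M h) | +-identityʳ (F (suc (suc M))) =
    subst (value M h + F (suc (suc M)) <_) (+-comm (F (suc M)) (F (suc (suc M))))
          (+-monoˡ-< (F (suc (suc M))) bound)

  value<F : ∀ M → value M h < F (suc M)
  value<F zero          = z<s
  value<F (suc zero)    = s≤s (subst (_≤ 1) (sym (*-identityʳ (h 1))) (h≤1 1))
  value<F (suc (suc M)) = value<F-step M (value<F M) (value<F (suc M))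

  top-chip : ∀ {k M} → suc k ≤ M → F (suc k) ≤ value M h → value M h < F (suc (suc k)) →
             VanishesOn (suc k) M h × h (suc k) ≡ 1 × value M h ≡ value k h + F (suc k)
  top-chip {k} {M} k<M lower upper = zeros-above , chip , value-split
    where
    zeros-above : VanishesOn (suc k) M h
    zeros-above (suc j) k<j j≤M =
      n<1⇒n≡0 (≰⇒> (λ 1≤h → <⇒≱ (<-≤-trans upper (F-mono k<j)) (F-≤-value h 1≤h j≤M)))
    value-top : value M h ≡ value (suc k) h
    value-top = value-extend h k<M zeros-above
    chip : h (suc k) ≡ 1
    chip with n≤1⇒n≡0∨n≡1 (h≤1 (suc k))
    ... | inj₂ full  = full
    ... | inj₁ empty = contradiction (subst (F (suc k) ≤_) value-top lower) (<⇒≱ below)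
      where
      below : value (suc k) h < F (suc k)
      below rewrite empty | +-identityʳ (value k h) = value<F k
    value-split : value M h ≡ value k h + F (suc k)
    value-split rewrite value-top | chip = cong (value k h +_) (+-identityʳ (F (suc k)))

zeckendorf-pair : ∀ t {h} → IsZeckendorf (F (4 + t) + F (suc t)) h →
                  ∀ j → h j ≡ δ (suc t) j + δ (4 + t) j
zeckendorf-pair t {h} (h0≡0 , h≤1 , no-consecutive , N , supp , value≡n) j = at (j ≟ suc t) (j ≟ 4 + t)
  where
  n : ℕ
  n = F (4 + t) + F (suc t)
  M : ℕ
  M = N ⊔ (4 + t)
  value-M : value M h ≡ n
  value-M = trans (value-extend h (m≤m⊔n N (4 + t)) (λ j N<j _ → supp j N<j)) value≡n
  n<F : n < F (5 + t)
  n<F = +-monoʳ-< (F (4 + t)) (m<n+m (F (suc t)) (F-pos (2 + t)))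
  upper : VanishesOn (4 + t) M h × h (4 + t) ≡ 1 × value M h ≡ value (3 + t) h + F (4 + t)
  upper = top-chip h≤1 no-consecutive {3 + t} {M} (m≤n⊔m N (4 + t))
            (subst (F (4 + t) ≤_) (sym value-M) (m≤m+n _ _)) (subst (_< F (5 + t)) (sym value-M) n<F)
  value₃ : value (3 + t) h ≡ F (suc t)
  value₃ = +-cancelʳ-≡ (F (4 + t)) _ _
             (trans (sym (proj₂ (proj₂ upper))) (trans value-M (+-comm (F (4 + t)) (F (suc t)))))
  lower : VanishesOn (suc t) (3 + t) h × h (suc t) ≡ 1 × value (3 + t) h ≡ value t h + F (suc t)
  lower = top-chip h≤1 no-consecutive {t} {3 + t} (m≤n+m (suc t) 2)
            (≤-reflexive (sym value₃)) (subst (_< F (2 + t)) (sym value₃) (m<m+n (F (suc t)) (F-pos t)))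
  value₀ : value t h ≡ 0
  value₀ = +-cancelʳ-≡ (F (suc t)) _ _ (trans (sym (proj₂ (proj₂ lower))) value₃)
  off-chips : ∀ j → j ≢ suc t → j ≢ 4 + t → h j ≡ 0
  off-chips zero _ _ = h0≡0
  off-chips (suc j) ≢₁ ≢₄ with suc j ≤? t
  ... | yes j≤t = value≡0⇒vanishes h value₀ (suc j) z<s j≤t
  ... | no j≰t with suc j ≤? 3 + t
  ...   | yes j≤3+t = proj₁ lower (suc j) (≤∧≢⇒< (≰⇒> j≰t) (≢-sym ≢₁)) j≤3+t
  ...   | no j≰3+t with suc j ≤? M
  ...     | yes j≤M = proj₁ upper (suc j) (≤∧≢⇒< (≰⇒> j≰3+t) (≢-sym ≢₄)) j≤M
  ...     | no j≰M  = supp (suc j) (≤-<-trans (m≤m⊔n N (4 + t)) (≰⇒> j≰M))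
  at : Dec (j ≡ suc t) → Dec (j ≡ 4 + t) → h j ≡ δ (suc t) j + δ (4 + t) j
  at (yes refl) _ rewrite δ-self (suc t) | δ-gt {4 + t} (m<n+m (suc t) {3} z<s) = proj₁ (proj₂ lower)
  at (no ≢₁) (yes refl) rewrite δ-self (4 + t) | δ-lt {suc t} (m<n+m (suc t) {3} z<s) = proj₁ (proj₂ upper)
  at (no ≢₁) (no ≢₄) rewrite δ-ne ≢₁ | δ-ne ≢₄ = off-chips j ≢₁ ≢₄

combine-pair : ∀ t {h} → (∀ j → h j ≡ δ (suc t) j + δ (4 + t) j) →
               Legal (combine (3 + t)) h × ∀ j → apply (combine (3 + t)) h j ≡ δ (3 + t) j + δ (3 + t) j
combine-pair t {h} h≗ = (s≤s (s≤s (s≤s z≤n)) , lower-chip , upper-chip) , result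
  where
  lower-chip : 1 ≤ h (suc t)
  lower-chip = subst (1 ≤_) (sym (h≗ (suc t))) (≤-trans (1≤δ-self (suc t)) (m≤m+n _ _))
  upper-chip : 1 ≤ h (4 + t)
  upper-chip = subst (1 ≤_) (sym (h≗ (4 + t))) (≤-trans (1≤δ-self (4 + t)) (m≤n+m _ _))
  result : ∀ j → apply (combine (3 + t)) h j ≡ δ (3 + t) j + δ (3 + t) j
  result j = begin
    apply (combine (3 + t)) h j
      ≡⟨ apply-pointwise (combine (3 + t)) h j ⟩
    h j ∸ (δ (4 + t) j + δ (suc t) j) + (δ (3 + t) j + δ (3 + t) j)
      ≡⟨ cong (_+ (δ (3 + t) j + δ (3 + t) j)) emptied ⟩
    δ (3 + t) j + δ (3 + t) j ∎
    where
    open ≡-Reasoning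
    emptied : h j ∸ (δ (4 + t) j + δ (suc t) j) ≡ 0
    emptied = trans (cong₂ _∸_ (h≗ j) (+-comm (δ (4 + t) j) (δ (suc t) j)))
                    (n∸n≡0 (δ (suc t) j + δ (4 + t) j))

theorem1p1 : (i : ℕ) → 3 ≤ i → (h : State) → IsZeckendorf (F (suc i) + F (i ∸ 2)) h → Win h
theorem1p1 .(3 + t) (s≤s (s≤s (s≤s {n = t} z≤n))) h zeck =
  win (apply (combine k) h) (combine k , legal , λ _ → refl) (even-state-loses k supported even)
  where
  k : ℕ
  k = 3 + t
  legal : Legal (combine k) h
  legal = proj₁ (combine-pair t (zeckendorf-pair t zeck))
  doubled : ∀ j → apply (combine k) h j ≡ δ k j + δ k j
  doubled = proj₂ (combine-pair t (zeckendorf-pair t zeck))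
  even : ∀ j → 2 ∣ apply (combine k) h j
  even j = subst (2 ∣_) (sym (doubled j)) (2∣n+n (δ k j))
  supported : Supported k (apply (combine k) h)
  supported j k<j = trans (doubled j) (cong₂ _+_ (δ-lt k<j) (δ-lt k<j))
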